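{- Let $\mathbf{K}$ be an arbitrary class of $\mathcal{L}$-algebras and let $\mathbb{R}^{\mathbb{I}}(\mathbf{K})$ be the smallest inductive rule class containing $\mathbf{K}$. Then $\mathbb{R}^{\mathbb{I}}(\mathbf{K})=\mathbb{I}\mathbb{S}_\forall\mathbb{P}\mathbb{P}_U(\mathbf{K})$, i.e., $\mathbb{R}^{\mathbb{I}}(\mathbf{K})$ is the class of algebras isomorphic to $\forall$-subalgebras of direct products of ultraproducts of members of $\mathbf{K}$.
   Context: $\mathcal{L}$ is an algebraic (functional) first-order language; atomic formulas are equations. For $\mathcal{L}$-algebras, $\mathcal{A}$ is a $\forall$-subalgebra of $\mathcal{B}$ if $\mathcal{A}$ is a subalgebra of $\mathcal{B}$ and for every atomic formula $\phi(\overline x,\overline y)$ and tuple $\overline a$ of elements of $A$, $\mathcal{A}\vDash\forall\overline x\phi(\overline x,\overline a)$ implies $\mathcal{B}\vDash\forall\overline x\phi(\overline x,\overline a)$. $\mathbb{S}_\forall,\mathbb{P},\mathbb{P}_U,\mathbb{I}$ denote closure under $\forall$-subalgebras, direct products, ultraproducts and isomorphic copies. An inductive rule class is a class closed under isomorphic copies of $\forall$-subalgebras, products and ultraproducts. -}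

module Defs where

open import Level using (Level; suc; _⊔_)
open import Data.Nat using (ℕ; zero) renaming (suc to sucℕ)
open import Data.Fin using (Fin) renaming (zero to fz; suc to fs)
open import Data.Sum using (_⊎_; [_,_])
open import Data.Product using (Σ; Σ-syntax; _×_; _,_; proj₁; proj₂)
open import Data.Unit.Polymorphic using (⊤)
open import Data.Empty.Polymorphic using (⊥)
open import Relation.Nullary using (¬_)
open import Relation.Binary using (IsEquivalence)
open import Function using (_∘_)

record Language (ℓ : Level) : Set (suc ℓ) where
  field
    Op    : Set ℓ
    arity : Op → ℕ

module _ {ℓ : Level} (L : Language ℓ) where
  open Language L

  -- L-algebras. Carriers are setoids (needed for ultraproducts, since
  -- Agda has no quotient types); equality in atomic formulas is the setoid equality.
  record Algebra : Set (suc ℓ) where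
    field
      Carrier : Set ℓ
      _≈_     : Carrier → Carrier → Set ℓ
      isEquiv : IsEquivalence _≈_
      ⟦_⟧     : (o : Op) → (Fin (arity o) → Carrier) → Carrier
      ⟦⟧-cong : ∀ o {xs ys : Fin (arity o) → Carrier} →
                (∀ k → xs k ≈ ys k) → ⟦ o ⟧ xs ≈ ⟦ o ⟧ ys
    open IsEquivalence isEquiv public

  open Algebra

  data Term (V : Set) : Set ℓ where
    var : V → Term V
    op  : (o : Op) → (Fin (arity o) → Term V) → Term V

  eval : (A : Algebra) {V : Set} → Term V → (V → Carrier A) → Carrier A
  eval A (var v)   ρ = ρ v
  eval A (op o ts) ρ = ⟦ A ⟧ o (λ k → eval A (ts k) ρ)

  -- An embedding A ↪ B: an injective homomorphism (A is isomorphic to a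
  -- subalgebra of B, namely its image).
  record Embedding (A B : Algebra) : Set ℓ where
    field
      fun       : Carrier A → Carrier B
      fun-cong  : ∀ {a a'} → _≈_ A a a' → _≈_ B (fun a) (fun a')
      injective : ∀ {a a'} → _≈_ B (fun a) (fun a') → _≈_ A a a'
      hom       : ∀ o (xs : Fin (arity o) → Carrier A) →
                  _≈_ B (fun (⟦ A ⟧ o xs)) (⟦ B ⟧ o (fun ∘ xs))

  -- An atomic formula φ(x̄, ȳ) with x̄ = x₁..xₘ and ȳ = y₁..yₖ is an equation
  -- s ≈ t between terms in the variables Fin m ⊎ Fin k (x̄ on the left, ȳ on the right).
  -- A ⊨ ∀x̄ φ(x̄, ā):
  SatAll : (A : Algebra) {m k : ℕ} → (s t : Term (Fin m ⊎ Fin k)) →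
           (Fin k → Carrier A) → Set ℓ
  SatAll A {m} s t a = ∀ (x : Fin m → Carrier A) →
    _≈_ A (eval A s [ x , a ]) (eval A t [ x , a ])

  -- A ∀-embedding: an embedding whose image is a ∀-subalgebra of B.
  -- "A is isomorphic to a ∀-subalgebra of B" iff there is a ∀-embedding A ↪ B.
  record ForallEmbedding (A B : Algebra) : Set ℓ where
    field
      emb : Embedding A B
    open Embedding emb public
    field
      reflects : ∀ {m k} (s t : Term (Fin m ⊎ Fin k)) (a : Fin k → Carrier A) →
                 SatAll A s t a → SatAll B s t (fun ∘ a)

  Π : (I : Set ℓ) → (I → Algebra) → Algebra
  Π I A = record
    { Carrier = ∀ i → Carrier (A i)
    ; _≈_     = λ f g → ∀ i → _≈_ (A i) (f i) (g i)
    ; isEquiv = record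
        { refl  = λ i → refl (A i)
        ; sym   = λ p i → sym (A i) (p i)
        ; trans = λ p q i → trans (A i) (p i) (q i) }
    ; ⟦_⟧     = λ o xs i → ⟦ A i ⟧ o (λ k → xs k i)
    ; ⟦⟧-cong = λ o p i → ⟦⟧-cong (A i) o (λ k → p k i)
    }

record Ultrafilter {ℓ : Level} (I : Set ℓ) : Set (suc ℓ) where
  field
    _∈U   : (I → Set ℓ) → Set ℓ
    whole : (λ _ → ⊤) ∈U
    proper : ¬ ((λ _ → ⊥) ∈U)
    mono  : ∀ {X Y : I → Set ℓ} → (∀ i → X i → Y i) → X ∈U → Y ∈U
    inter : ∀ {X Y : I → Set ℓ} → X ∈U → Y ∈U → (λ i → X i × Y i) ∈U
    ultra : ∀ (X : I → Set ℓ) → X ∈U ⊎ (λ i → ¬ X i) ∈U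

  bigInter : ∀ n (X : Fin n → I → Set ℓ) → (∀ k → X k ∈U) → (λ i → ∀ k → X k i) ∈U
  bigInter zero X h = mono (λ i _ ()) whole
  bigInter (sucℕ n) X h =
    mono (λ i p → λ { fz → proj₁ p ; (fs k) → proj₂ p k })
         (inter (h fz) (bigInter n (X ∘ fs) (h ∘ fs)))

module _ {ℓ : Level} (L : Language ℓ) where
  open Language L
  open Algebra

  Ultraproduct : (I : Set ℓ) → Ultrafilter I → (I → Algebra L) → Algebra L
  Ultraproduct I U A = record
    { Carrier = ∀ i → Carrier (A i)
    ; _≈_     = λ f g → (λ i → _≈_ (A i) (f i) (g i)) ∈U
    ; isEquiv = record
        { refl  = mono (λ i _ → refl (A i)) whole
        ; sym   = mono (λ i → sym (A i))
        ; trans = λ p q → mono (λ i r → trans (A i) (proj₁ r) (proj₂ r)) (inter p q) }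
    ; ⟦_⟧     = λ o xs i → ⟦ A i ⟧ o (λ k → xs k i)
    ; ⟦⟧-cong = λ o {xs} {ys} p →
        mono (λ i r → ⟦⟧-cong (A i) o r)
             (bigInter (arity o) (λ k i → _≈_ (A i) (xs k i) (ys k i)) p)
    }
    where open Ultrafilter U

  Class : Set (suc (suc ℓ))
  Class = Algebra L → Set (suc ℓ)

  record InductiveRuleClass (C : Class) : Set (suc ℓ) where
    field
      closed-S∀ : ∀ {A B} → ForallEmbedding L A B → C B → C A
      closed-P  : ∀ (I : Set ℓ) (A : I → Algebra L) → (∀ i → C (A i)) → C (Π L I A)
      closed-PU : ∀ (I : Set ℓ) (U : Ultrafilter I) (A : I → Algebra L) →
                  (∀ i → C (A i)) → C (Ultraproduct I U A)

  RI : Class → Algebra L → Set (suc (suc ℓ))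
  RI K A = ∀ (C : Class) → InductiveRuleClass C → (∀ B → K B → C B) → C A

  ISPPU : Class → Algebra L → Set (suc ℓ)
  ISPPU K A =
    Σ[ I ∈ Set ℓ ] Σ[ J ∈ (I → Set ℓ) ] Σ[ U ∈ ((i : I) → Ultrafilter (J i)) ]
    Σ[ B ∈ ((i : I) → J i → Algebra L) ]
      ((∀ i j → K (B i j)) ×
       ForallEmbedding L A (Π L I (λ i → Ultraproduct (J i) (U i) (B i))))

{-# OPTIONS --safe #-}
-- Every inductive rule class containing K contains ISPPU(K), and ISPPU(K) contains K, so it
-- suffices that ISPPU(K) is an inductive rule class. Since projections out of an inhabited
-- product preserve universal sentences, A is in ISPPU(K) iff it is separated by
-- ∀-homomorphisms into ultraproducts of members of K. Such separating families pull back along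
-- ∀-embeddings and combine over products. For an ultraproduct along W, every choice of one
-- factor for W-almost all coordinates gives, by Łoś's theorem for universal sentences, a
-- ∀-homomorphism into an ultraproduct along the sum ultrafilter, and these choices separate
-- points. Excluded middle enters through Łoś, principal ultrafilters and empty algebras.
module Submission where

open import Defs
open import Level using (Level; suc; Lift; lift; lower)
open import Axiom.ExcludedMiddle using (ExcludedMiddle)
open import Data.Product using (_×_; Σ; ∃; _,_; proj₁; proj₂)
open import Data.Sum using (_⊎_; inj₁; inj₂; [_,_]; fromInj₂; map₂)
open import Data.Maybe using (Maybe; just; nothing)
open import Data.Nat using (ℕ)
open import Data.Fin using (Fin)
open import Data.Unit.Polymorphic using (⊤; tt)
open import Data.Empty.Polymorphic using (⊥)
import Data.Empty as Empty
open import Relation.Nullary using (¬_; Dec; yes; no)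
open import Relation.Nullary.Decidable using (map′; decidable-stable; toSum)
open import Relation.Binary.PropositionalEquality using (_≡_) renaming (refl to ≡-refl)
open import Function using (_∘_)

module _ {ℓ : Level} where

  infix 4 _∈_ _∈?_

  _∈_ : {I : Set ℓ} → (I → Set ℓ) → Ultrafilter I → Set ℓ
  X ∈ W = Ultrafilter._∈U W X

  module _ {I : Set ℓ} (W : Ultrafilter I) where
    open Ultrafilter W

    complement : {X : I → Set ℓ} → ¬ X ∈ W → (λ i → ¬ X i) ∈ W
    complement {X} X∉W = fromInj₂ (Empty.⊥-elim ∘ X∉W) (ultra X)

    disjoint : {X Y : I → Set ℓ} → X ∈ W → Y ∈ W → (∀ i → X i → Y i → Empty.⊥) → Empty.⊥
    disjoint X∈W Y∈W apart = proper (mono (λ i (x , y) → lift (apart i x y)) (inter X∈W Y∈W))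

  _∈?_ : {J : Set ℓ} → (J → Set ℓ) → Maybe (Ultrafilter J) → Set ℓ
  X ∈? just V  = X ∈ V
  X ∈? nothing = ⊥

  Defined : {J : Set ℓ} → Maybe (Ultrafilter J) → Set ℓ
  Defined v = (λ _ → ⊤) ∈? v

  module _ {J : Set ℓ} where

    ∈?-mono : (v : Maybe (Ultrafilter J)) {X Y : J → Set ℓ} → (∀ j → X j → Y j) → X ∈? v → Y ∈? v
    ∈?-mono (just V) = Ultrafilter.mono V
    ∈?-mono nothing _ ()

    ∈?-inter : (v : Maybe (Ultrafilter J)) {X Y : J → Set ℓ} → X ∈? v → Y ∈? v → (λ j → X j × Y j) ∈? v
    ∈?-inter (just V) = Ultrafilter.inter V
    ∈?-inter nothing ()

    ∈?-proper : (v : Maybe (Ultrafilter J)) → ¬ (λ _ → ⊥) ∈? v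
    ∈?-proper (just V) = Ultrafilter.proper V
    ∈?-proper nothing ()

    ∈?-complement : (v : Maybe (Ultrafilter J)) {X : J → Set ℓ} → Defined v → ¬ X ∈? v → (λ j → ¬ X j) ∈? v
    ∈?-complement (just V) _ = complement V
    ∈?-complement nothing ()

  ΣUltrafilter : {I : Set ℓ} {J : I → Set ℓ} (W : Ultrafilter I) (V : ∀ k → Maybe (Ultrafilter (J k))) →
                 (λ k → Defined (V k)) ∈ W → Ultrafilter (Σ I J)
  ΣUltrafilter {I} {J} W V defined = record
    { _∈U    = λ Z → section Z ∈ W
    ; whole  = defined
    ; proper = λ ∅∈ → proper (mono (λ k ∅ₖ → Empty.⊥-elim (∈?-proper (V k) ∅ₖ)) ∅∈)
    ; mono   = λ Z⊆Z′ → mono (λ k → ∈?-mono (V k) (λ j → Z⊆Z′ (k , j)))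
    ; inter  = λ Z∈ Z′∈ → mono (λ k (z , z′) → ∈?-inter (V k) z z′) (inter Z∈ Z′∈)
    ; ultra  = λ Z → map₂ (λ ∁Z∈ → mono (λ k (d , z∉) → ∈?-complement (V k) d z∉) (inter defined ∁Z∈))
                          (ultra (section Z))
    }
    where
      open Ultrafilter W
      section : (Σ I J → Set ℓ) → I → Set ℓ
      section Z k = (λ j → Z (k , j)) ∈? V k

module _ {ℓ : Level} {L : Language ℓ} where
  open Language L
  open Algebra using (Carrier; ⟦_⟧; ⟦⟧-cong; refl; sym; trans)

  infix 4 _⊢_≈_

  _⊢_≈_ : (A : Algebra L) → Carrier A → Carrier A → Set ℓ
  A ⊢ x ≈ y = Algebra._≈_ A x y

  Homomorphic : (A B : Algebra L) → (Carrier A → Carrier B) → Set ℓ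
  Homomorphic A B h = ∀ o xs → B ⊢ h (⟦ A ⟧ o xs) ≈ ⟦ B ⟧ o (h ∘ xs)

  Holds : (A : Algebra L) {m k : ℕ} (s t : Term L (Fin m ⊎ Fin k)) → (Fin m → Carrier A) → (Fin k → Carrier A) → Set ℓ
  Holds A s t x a = A ⊢ eval L A s [ x , a ] ≈ eval L A t [ x , a ]

  _at_ : {I : Set ℓ} {X : I → Set ℓ} {m : ℕ} → (Fin m → ∀ i → X i) → (i : I) → Fin m → X i
  (x at i) l = x l i

  eval-cong : (A : Algebra L) {V : Set} (t : Term L V) {ρ ρ′ : V → Carrier A} →
              (∀ v → A ⊢ ρ v ≈ ρ′ v) → A ⊢ eval L A t ρ ≈ eval L A t ρ′
  eval-cong A (var v)   ρ≈ρ′ = ρ≈ρ′ v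
  eval-cong A (op o ts) ρ≈ρ′ = ⟦⟧-cong A o (λ k → eval-cong A (ts k) ρ≈ρ′)

  -- h need not respect ≈, so the coordinate maps of an ultraproduct qualify.
  eval-hom : (A B : Algebra L) (h : Carrier A → Carrier B) → Homomorphic A B h →
             {V : Set} (t : Term L V) (ρ : V → Carrier A) → B ⊢ h (eval L A t ρ) ≈ eval L B t (h ∘ ρ)
  eval-hom A B h h-hom (var v)   ρ = refl B
  eval-hom A B h h-hom (op o ts) ρ = trans B (h-hom o _) (⟦⟧-cong B o (λ k → eval-hom A B h h-hom (ts k) ρ))

  module _ (A B : Algebra L) (h : Carrier A → Carrier B) (h-hom : Homomorphic A B h)
           {m k : ℕ} (s t : Term L (Fin m ⊎ Fin k)) (x : Fin m → Carrier A) (a : Fin k → Carrier A) where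

    eval-hom-[,] : (u : Term L (Fin m ⊎ Fin k)) → B ⊢ h (eval L A u [ x , a ]) ≈ eval L B u [ h ∘ x , h ∘ a ]
    eval-hom-[,] u = trans B (eval-hom A B h h-hom u _) (eval-cong B u λ { (inj₁ _) → refl B ; (inj₂ _) → refl B })

    lift-equation : Holds B s t (h ∘ x) (h ∘ a) → B ⊢ h (eval L A s [ x , a ]) ≈ h (eval L A t [ x , a ])
    lift-equation holds = trans B (eval-hom-[,] s) (trans B holds (sym B (eval-hom-[,] t)))

    lower-equation : B ⊢ h (eval L A s [ x , a ]) ≈ h (eval L A t [ x , a ]) → Holds B s t (h ∘ x) (h ∘ a)
    lower-equation eq = trans B (sym B (eval-hom-[,] s)) (trans B eq (eval-hom-[,] t))

  module _ {I : Set ℓ} (C : I → Algebra L) {m k : ℕ} (s t : Term L (Fin m ⊎ Fin k))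
           (x : Fin m → ∀ i → Carrier (C i)) (a : Fin k → ∀ i → Carrier (C i)) where

    Holds-Π⁺ : (∀ i → Holds (C i) s t (x at i) (a at i)) → Holds (Π L I C) s t x a
    Holds-Π⁺ holds i = lift-equation (Π L I C) (C i) (λ f → f i) (λ _ _ → refl (C i)) s t x a (holds i)

    Holds-Π⁻ : Holds (Π L I C) s t x a → ∀ i → Holds (C i) s t (x at i) (a at i)
    Holds-Π⁻ holds i = lower-equation (Π L I C) (C i) (λ f → f i) (λ _ _ → refl (C i)) s t x a (holds i)

    module _ (U : Ultrafilter I) where
      open Ultrafilter U

      Łoś-atomic⁺ : (λ i → Holds (C i) s t (x at i) (a at i)) ∈ U → Holds (Ultraproduct L I U C) s t x a
      Łoś-atomic⁺ = mono λ i → lift-equation (Ultraproduct L I U C) (C i) (λ f → f i) (λ _ _ → refl (C i)) s t x a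

      Łoś-atomic⁻ : Holds (Ultraproduct L I U C) s t x a → (λ i → Holds (C i) s t (x at i) (a at i)) ∈ U
      Łoś-atomic⁻ = mono λ i → lower-equation (Ultraproduct L I U C) (C i) (λ f → f i) (λ _ _ → refl (C i)) s t x a

  record UniversalHom (A B : Algebra L) : Set ℓ where
    field
      fun       : Carrier A → Carrier B
      fun-cong  : ∀ {a a′} → A ⊢ a ≈ a′ → B ⊢ fun a ≈ fun a′
      hom       : Homomorphic A B fun
      preserves : ∀ {m k} (s t : Term L (Fin m ⊎ Fin k)) (a : Fin k → Carrier A) →
                  SatAll L A s t a → SatAll L B s t (fun ∘ a)

  open UniversalHom

  infixr 9 _∘ʰ_

  _∘ʰ_ : {A B C : Algebra L} → UniversalHom B C → UniversalHom A B → UniversalHom A C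
  _∘ʰ_ {C = C} g f = record
    { fun       = fun g ∘ fun f
    ; fun-cong  = fun-cong g ∘ fun-cong f
    ; hom       = λ o xs → trans C (fun-cong g (hom f o xs)) (hom g o (fun f ∘ xs))
    ; preserves = λ s t a → preserves g s t (fun f ∘ a) ∘ preserves f s t a
    }

  universalHom : {A B : Algebra L} → ForallEmbedding L A B → UniversalHom A B
  universalHom e = record { fun = E.fun ; fun-cong = E.fun-cong ; hom = E.hom ; preserves = E.reflects }
    where module E = ForallEmbedding e

  ⟨_⟩ʰ : {A : Algebra L} {I : Set ℓ} {C : I → Algebra L} → (∀ i → UniversalHom A (C i)) → UniversalHom A (Π L I C)
  ⟨_⟩ʰ {C = C} g = record
    { fun       = λ a i → fun (g i) a
    ; fun-cong  = λ a≈a′ i → fun-cong (g i) a≈a′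
    ; hom       = λ o xs i → hom (g i) o xs
    ; preserves = λ s t a sat x → Holds-Π⁺ C s t x _ (λ i → preserves (g i) s t a sat (x at i))
    }

  universalHom⇒ForallEmbedding : {A B : Algebra L} (f : UniversalHom A B) →
    (∀ {a a′} → B ⊢ fun f a ≈ fun f a′ → A ⊢ a ≈ a′) → ForallEmbedding L A B
  universalHom⇒ForallEmbedding f injective = record
    { emb      = record { fun = fun f ; fun-cong = fun-cong f ; injective = injective ; hom = hom f }
    ; reflects = preserves f
    }

  diagonal : {I : Set ℓ} (U : Ultrafilter I) (A : Algebra L) → UniversalHom A (Ultraproduct L I U (λ _ → A))
  diagonal U A = record
    { fun       = λ a _ → a
    ; fun-cong  = λ a≈a′ → mono (λ _ _ → a≈a′) whole
    ; hom       = λ o xs → mono (λ _ _ → refl A) whole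
    ; preserves = λ s t a sat x → Łoś-atomic⁺ (λ _ → A) s t x _ U (mono (λ i _ → sat (x at i)) whole)
    }
    where open Ultrafilter U

  module _ (K : Class L) where

    -- ISPPU in per-factor form: A is separated by ∀-homomorphisms into ultraproducts of members of K.
    record Representation (A : Algebra L) : Set (suc ℓ) where
      field
        I          : Set ℓ
        J          : I → Set ℓ
        U          : ∀ i → Ultrafilter (J i)
        B          : ∀ i → J i → Algebra L
        inK        : ∀ i j → K (B i j)
        map        : ∀ i → UniversalHom A (Ultraproduct L (J i) (U i) (B i))
        separating : ∀ {a a′} → (∀ i → Ultraproduct L (J i) (U i) (B i) ⊢ fun (map i) a ≈ fun (map i) a′) →
                     A ⊢ a ≈ a′

    Representation⇒ISPPU : {A : Algebra L} → Representation A → ISPPU L K A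
    Representation⇒ISPPU R = I , J , U , B , inK , universalHom⇒ForallEmbedding ⟨ map ⟩ʰ separating
      where open Representation R

    representation-trivial : {A : Algebra L} → (∀ a a′ → A ⊢ a ≈ a′) → Representation A
    representation-trivial trivial = record
      { I = ⊥ ; J = λ () ; U = λ () ; B = λ () ; inK = λ () ; map = λ ()
      ; separating = λ {a} {a′} _ → trivial a a′ }

    representation-S∀ : {A B : Algebra L} → ForallEmbedding L A B → Representation B → Representation A
    representation-S∀ e R = record
      { I = I ; J = J ; U = U ; B = B ; inK = inK
      ; map = λ i → map i ∘ʰ universalHom e
      ; separating = injective ∘ separating }
      where
        open Representation R
        open ForallEmbedding e using (injective)

  module _ (em : ExcludedMiddle (suc ℓ)) where

    dec : (P : Set ℓ) → Dec P
    dec P = map′ lower lift (em {Lift (suc ℓ) P})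

    dne : {P : Set ℓ} → ¬ ¬ P → P
    dne = decidable-stable (dec _)

    ¬∀⇒∃¬ : {X : Set ℓ} {P : X → Set ℓ} → ¬ (∀ x → P x) → ∃ λ x → ¬ P x
    ¬∀⇒∃¬ ¬∀ = dne λ ¬∃ → ¬∀ λ x → dne λ ¬Px → ¬∃ (x , ¬Px)

    principal : {I : Set ℓ} → I → Ultrafilter I
    principal i = record
      { _∈U = λ X → X i ; whole = tt ; proper = lower ; mono = λ X⊆Y → X⊆Y i ; inter = _,_
      ; ultra = λ X → toSum (dec (X i)) }

    insert : {I : Set ℓ} {X : I → Set ℓ} → (∀ j → X j) → (i : I) → X i → ∀ j → X j
    insert c i z j with dec (i ≡ j)
    ... | yes ≡-refl = z
    ... | no _       = c j

    insert-self : {I : Set ℓ} (C : I → Algebra L) (c : ∀ j → Carrier (C j)) (i : I) (z : Carrier (C i)) →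
                  C i ⊢ insert c i z i ≈ z
    insert-self C c i z with dec (i ≡ i)
    ... | yes ≡-refl = refl (C i)
    ... | no i≢i     = Empty.⊥-elim (i≢i ≡-refl)

    -- Projections out of an inhabited product preserve universal sentences: a counterexample
    -- in one factor is padded with the given element c in the other factors.
    projection : {I : Set ℓ} {C : I → Algebra L} → Carrier (Π L I C) → (i : I) → UniversalHom (Π L I C) (C i)
    projection {C = C} c i = record
      { fun       = λ f → f i
      ; fun-cong  = λ f≈g → f≈g i
      ; hom       = λ _ _ → refl (C i)
      ; preserves = λ s t a sat y →
          let x = λ l → insert c i (y l)
              y≈x = λ { (inj₁ l) → sym (C i) (insert-self C c i (y l)) ; (inj₂ _) → refl (C i) }
          in trans (C i) (eval-cong (C i) s y≈x)
               (trans (C i) (Holds-Π⁻ C s t x a (sat x) i) (sym (C i) (eval-cong (C i) t y≈x)))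
      }

    Łoś-∀ : {I : Set ℓ} (W : Ultrafilter I) (A : I → Algebra L) → (∀ k → Carrier (A k)) →
            {m n : ℕ} (s t : Term L (Fin m ⊎ Fin n)) (a : Fin n → Carrier (Ultraproduct L I W A)) →
            SatAll L (Ultraproduct L I W A) s t a → (λ k → SatAll L (A k) s t (a at k)) ∈ W
    Łoś-∀ W A c {m} s t a sat = dne λ ∉ →
      disjoint W (Łoś-atomic⁻ A s t x a W (sat x)) (complement W ∉) refutes
      where
        counterexample : ∀ k → Dec (SatAll L (A k) s t (a at k)) → Fin m → Carrier (A k)
        counterexample k (yes _)   = λ _ → c k
        counterexample k (no ¬sat) = proj₁ (¬∀⇒∃¬ ¬sat)

        x : Fin m → Carrier (Ultraproduct L _ W A)
        x l k = counterexample k (dec _) l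

        refutes : ∀ k → Holds (A k) s t (x at k) (a at k) → ¬ SatAll L (A k) s t (a at k) → Empty.⊥
        refutes k with dec (SatAll L (A k) s t (a at k))
        ... | yes satₖ = λ _ ¬satₖ → ¬satₖ satₖ
        ... | no ¬satₖ = λ holds _ → proj₂ (¬∀⇒∃¬ ¬satₖ) holds

    module _ (K : Class L) where
      open Representation

      representation-by-cases : {A : Algebra L} → (Carrier A → Representation K A) → Representation K A
      representation-by-cases {A} inhabited with dec (Carrier A)
      ... | yes a = inhabited a
      ... | no ¬a = representation-trivial K (λ a _ → Empty.⊥-elim (¬a a))

      ISPPU⇒Representation : {A : Algebra L} → ISPPU L K A → Representation K A
      ISPPU⇒Representation (I , J , U , B , inK , e) = representation-by-cases λ a → record
        { I = I ; J = J ; U = U ; B = B ; inK = inK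
        ; map = λ i → projection {C = λ i → Ultraproduct L (J i) (U i) (B i)} (E.fun a) i ∘ʰ universalHom e
        ; separating = E.injective }
        where module E = ForallEmbedding e

      representation-K : {A : Algebra L} → K A → Representation K A
      representation-K {A} A∈K = record
        { I = ⊤ ; J = λ _ → ⊤ ; U = λ _ → principal tt ; B = λ _ _ → A ; inK = λ _ _ → A∈K
        ; map = λ _ → diagonal (principal tt) A
        ; separating = λ images≈ → images≈ tt }

      representation-Π : {I₀ : Set ℓ} (A : I₀ → Algebra L) → (∀ k → Representation K (A k)) →
                         Representation K (Π L I₀ A)
      representation-Π {I₀} A R = representation-by-cases λ a → record
        { I = Σ I₀ (I ∘ R)
        ; J = λ (k , i) → J (R k) i
        ; U = λ (k , i) → U (R k) i
        ; B = λ (k , i) → B (R k) i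
        ; inK = λ (k , i) → inK (R k) i
        ; map = λ (k , i) → map (R k) i ∘ʰ projection {C = A} a k
        ; separating = λ images≈ k → separating (R k) (λ i → images≈ (k , i)) }

      -- The choice nothing selects no factor: empty index set, no ultrafilter.
      module Optional {A : Algebra L} (R : Representation K A) where

        J? : Maybe (I R) → Set ℓ
        J? (just i) = J R i
        J? nothing  = ⊥

        U? : ∀ i? → Maybe (Ultrafilter (J? i?))
        U? (just i) = just (U R i)
        U? nothing  = nothing

        B? : ∀ i? → J? i? → Algebra L
        B? (just i) = B R i
        B? nothing  = λ ()

        inK? : ∀ i? j → K (B? i? j)
        inK? (just i) = inK R i
        inK? nothing  = λ ()

        map? : ∀ i? → Carrier A → (j : J? i?) → Carrier (B? i? j)
        map? (just i)  = fun (map R i)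
        map? nothing _ = λ ()

        map?-cong : ∀ i? → Defined (U? i?) → ∀ {a a′} → A ⊢ a ≈ a′ →
                    (λ j → B? i? j ⊢ map? i? a j ≈ map? i? a′ j) ∈? U? i?
        map?-cong (just i) _ = fun-cong (map R i)
        map?-cong nothing ()

        map?-hom : ∀ i? → Defined (U? i?) → ∀ o xs →
                   (λ j → B? i? j ⊢ map? i? (⟦ A ⟧ o xs) j ≈ ⟦ B? i? j ⟧ o (λ l → map? i? (xs l) j)) ∈? U? i?
        map?-hom (just i) _ = hom (map R i)
        map?-hom nothing ()

        map?-preserves : ∀ i? → Defined (U? i?) → ∀ {m k} (s t : Term L (Fin m ⊎ Fin k)) (a : Fin k → Carrier A) →
                         SatAll L A s t a → (y : Fin m → ∀ j → Carrier (B? i? j)) →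
                         (λ j → Holds (B? i? j) s t (y at j) (λ l → map? i? (a l) j)) ∈? U? i?
        map?-preserves (just i) _ s t a sat y = Łoś-atomic⁻ (B R i) s t y _ (U R i) (preserves (map R i) s t a sat y)
        map?-preserves nothing ()

        Separates : I R → Carrier A → Carrier A → Set ℓ
        Separates i a a′ = ¬ Ultraproduct L (J R i) (U R i) (B R i) ⊢ fun (map R i) a ≈ fun (map R i) a′

        separator : Carrier A → Carrier A → Maybe (I R)
        separator a a′ with dec (∃ λ i → Separates i a a′)
        ... | yes (i , _) = just i
        ... | no _        = nothing

        separator-defined : ∀ {a a′} → ¬ A ⊢ a ≈ a′ → Defined (U? (separator a a′))
        separator-defined {a} {a′} a≉a′ with dec (∃ λ i → Separates i a a′)
        ... | yes (i , _) = Ultrafilter.whole (U R i)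
        ... | no ¬∃       = Empty.⊥-elim (a≉a′ (separating R λ i → dne λ i-separates → ¬∃ (i , i-separates)))

        separator-separates : ∀ a a′ →
          ¬ (λ j → B? (separator a a′) j ⊢ map? (separator a a′) a j ≈ map? (separator a a′) a′ j) ∈? U? (separator a a′)
        separator-separates a a′ with dec (∃ λ i → Separates i a a′)
        ... | yes (_ , i-separates) = i-separates
        ... | no _                  = lower

      -- A choice of one factor of each A k, defined W-almost everywhere, yields one factor of the
      -- ultraproduct: the ultraproduct of the chosen factors' components along the sum ultrafilter.
      module UltraproductRepresentation {I₀ : Set ℓ} (W : Ultrafilter I₀) (A : I₀ → Algebra L)
                                        (R : ∀ k → Representation K (A k)) where
        open Ultrafilter W
        module O k = Optional (R k)
        open O

        Choice : Set ℓ
        Choice = Σ (∀ k → Maybe (I (R k))) λ f → (λ k → Defined (U? k (f k))) ∈ W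

        ChosenIndex : Choice → Set ℓ
        ChosenIndex (f , _) = Σ I₀ λ k → J? k (f k)

        chosenUltrafilter : (F : Choice) → Ultrafilter (ChosenIndex F)
        chosenUltrafilter (f , defined) = ΣUltrafilter W (λ k → U? k (f k)) defined

        chosenAlgebra : (F : Choice) → ChosenIndex F → Algebra L
        chosenAlgebra (f , _) (k , j) = B? k (f k) j

        chosenAlgebra∈K : ∀ F j → K (chosenAlgebra F j)
        chosenAlgebra∈K (f , _) (k , j) = inK? k (f k) j

        chosenFactor : Choice → Algebra L
        chosenFactor F = Ultraproduct L _ (chosenUltrafilter F) (chosenAlgebra F)

        chosenHom : (∀ k → Carrier (A k)) → (F : Choice) → UniversalHom (Ultraproduct L I₀ W A) (chosenFactor F)
        chosenHom c F@(f , defined) = record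
          { fun       = λ a (k , j) → map? k (f k) (a k) j
          ; fun-cong  = λ a≈a′ → mono (λ k (a≈a′ₖ , dₖ) → map?-cong k (f k) dₖ a≈a′ₖ) (inter a≈a′ defined)
          ; hom       = λ o xs → mono (λ k dₖ → map?-hom k (f k) dₖ o (xs at k)) defined
          ; preserves = λ s t a sat x → Łoś-atomic⁺ (chosenAlgebra F) s t x _ (chosenUltrafilter F)
              (mono (λ k (satₖ , dₖ) → map?-preserves k (f k) dₖ s t (a at k) satₖ (λ l j → x l (k , j)))
                    (inter (Łoś-∀ W A c s t a sat) defined))
          }

        -- If a and a′ differ W-almost everywhere, choose at each such k a factor separating them.
        choices-separate : (c : ∀ k → Carrier (A k)) {a a′ : Carrier (Ultraproduct L I₀ W A)} →
          (∀ F → chosenFactor F ⊢ fun (chosenHom c F) a ≈ fun (chosenHom c F) a′) → Ultraproduct L I₀ W A ⊢ a ≈ a′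
        choices-separate c {a} {a′} images≈ = dne λ a≉a′ →
          let f k = separator k (a k) (a′ k)
              defined = mono (λ k → separator-defined k) (complement W a≉a′)
          in proper (mono (λ k imagesₖ≈ → Empty.⊥-elim (separator-separates k (a k) (a′ k) imagesₖ≈))
                          (images≈ (f , defined)))

      representation-UP : {I₀ : Set ℓ} (W : Ultrafilter I₀) (A : I₀ → Algebra L) → (∀ k → Representation K (A k)) →
                          Representation K (Ultraproduct L I₀ W A)
      representation-UP W A R = representation-by-cases λ c → record
        { I = Choice
        ; J = ChosenIndex
        ; U = chosenUltrafilter
        ; B = chosenAlgebra
        ; inK = chosenAlgebra∈K
        ; map = chosenHom c
        ; separating = choices-separate c }
        where open UltraproductRepresentation W A R

      ISPPU-inductive : InductiveRuleClass L (ISPPU L K)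
      ISPPU-inductive = record
        { closed-S∀ = λ e A∈ → Representation⇒ISPPU K (representation-S∀ K e (ISPPU⇒Representation A∈))
        ; closed-P  = λ _ A A∈ → Representation⇒ISPPU K (representation-Π A (ISPPU⇒Representation ∘ A∈))
        ; closed-PU = λ _ U A A∈ → Representation⇒ISPPU K (representation-UP U A (ISPPU⇒Representation ∘ A∈))
        }

theorem3p7 : {ℓ : Level} → ExcludedMiddle (suc ℓ) → (L : Language ℓ) → (K : Class L) →
    (A : Algebra L) → (RI L K A → ISPPU L K A) × (ISPPU L K A → RI L K A)
theorem3p7 em L K A = RI⊆ISPPU , ISPPU⊆RI
  where
    RI⊆ISPPU : RI L K A → ISPPU L K A
    RI⊆ISPPU A∈RI = A∈RI (ISPPU L K) (ISPPU-inductive em K) λ B B∈K →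
      Representation⇒ISPPU K (representation-K em K B∈K)

    ISPPU⊆RI : ISPPU L K A → RI L K A
    ISPPU⊆RI (I , J , U , B , inK , e) C C-inductive K⊆C =
      closed-S∀ e (closed-P I _ λ i → closed-PU (J i) (U i) (B i) λ j → K⊆C _ (inK i j))
      where open InductiveRuleClass C-inductive
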